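{- Let $c\geq 5$ and let $G_c$ be a graph that has no PCF $c$-coloring but every proper subgraph of $G_c$ has a PCF $c$-coloring. Let $v$ be a vertex of $G_c$ that has a neighbor of degree $2$. Then $2d(v)\geq n_2(v)+c$. Moreover, if $c\geq 7$, then $2d(v)\geq n_2(v)+n_3(v)+c$.
   Context: All graphs are finite and simple. A PCF $c$-coloring of a graph is a proper vertex coloring with at most $c$ colors such that every non-isolated vertex has some color appearing exactly once in its neighborhood; the null graph is considered to have a PCF $c$-coloring. $d(v)$ denotes the degree of $v$, and $n_i(v)$ the number of neighbors of $v$ of degree exactly $i$. -}

module Defs where

open import Data.Nat using (ℕ; zero; suc; _+_; _≡ᵇ_)
open import Data.Bool using (Bool; true; false; _∧_; if_then_else_)
open import Data.Fin using (Fin; zero; suc)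
import Data.Fin as F
open import Data.Product using (Σ; ∃; ∃-syntax; _×_; _,_)
open import Data.Sum using (_⊎_)
open import Data.Empty using (⊥)
open import Relation.Binary.PropositionalEquality using (_≡_; _≢_)
open import Relation.Nullary.Decidable using (⌊_⌋)

count : ∀ {n} → (Fin n → Bool) → ℕ
count {zero} p = 0
count {suc n} p = (if p zero then 1 else 0) + count (λ i → p (suc i))

record Graph (n : ℕ) : Set where
  field
    adj    : Fin n → Fin n → Bool
    sym    : ∀ u v → adj u v ≡ adj v u
    irrefl : ∀ u → adj u u ≡ false
open Graph public

deg : ∀ {n} → Graph n → Fin n → ℕ
deg G v = count (λ w → adj G v w)

nbrsOfDeg : ∀ {n} → Graph n → ℕ → Fin n → ℕ
nbrsOfDeg G i v = count (λ w → adj G v w ∧ (deg G w ≡ᵇ i))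

record Subgraph {n : ℕ} (G : Graph n) : Set where
  field
    vs     : Fin n → Bool
    es     : Fin n → Fin n → Bool
    es-sym : ∀ u v → es u v ≡ es v u
    es-sub : ∀ u v → es u v ≡ true → adj G u v ≡ true
    es-end : ∀ u v → es u v ≡ true → vs u ≡ true
open Subgraph public

whole : ∀ {n} (G : Graph n) → Subgraph G
whole G = record
  { vs = λ _ → true ; es = adj G ; es-sym = sym G
  ; es-sub = λ _ _ e → e ; es-end = λ _ _ _ → _≡_.refl }

Proper : ∀ {n} {G : Graph n} → Subgraph G → Set
Proper {n} {G} H =
  (∃[ u ] vs H u ≡ false) ⊎ (∃[ u ] ∃[ v ] (adj G u v ≡ true × es H u v ≡ false))

-- A PCF c-colouring of the subgraph H (colours Fin c; values on vertices
-- outside H are irrelevant): proper, and every non-isolated vertex of H has a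
-- colour appearing exactly once in its H-neighbourhood.
record PCFColoring {n : ℕ} {G : Graph n} (c : ℕ) (H : Subgraph G) : Set where
  field
    col    : Fin n → Fin c
    proper : ∀ u v → es H u v ≡ true → col u ≢ col v
    pcf    : ∀ u → vs H u ≡ true → (∃[ w ] es H u w ≡ true) →
             ∃[ k ] count (λ w → es H u w ∧ ⌊ col w F.≟ k ⌋) ≡ 1

PCFCritical : ∀ {n} → ℕ → Graph n → Set
PCFCritical c G =
  (PCFColoring c (whole G) → ⊥) × (∀ (H : Subgraph G) → Proper H → PCFColoring c H)

-- Let D be the neighbours of v of degree 2 (and of degree 3 too when c ≥ 7), A the other neighbours,
-- and suppose 2 d(v) < |D| + c, i.e. 2|A| + |D| < c. Deleting D ∪ {v} leaves a proper subgraph with a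
-- PCF colouring φ. Fix for each u ∈ D a neighbour of u outside D ∪ {v} (its anchor), if it has one.
-- Colour v by a β avoiding the colours and unique colours of A and the colours of all anchors; colour
-- a degree-2 neighbour w by an α new on A ∪ {v} and on the other neighbour of w, so that α is unique
-- at v; then colour the rest of D greedily, each vertex avoiding the colours and unique colours of its
-- at most 3 neighbours (2 d(u) < c). Each u ∈ D has a unique colour: β at v, unless another neighbour
-- is coloured β; that neighbour is not in D (D is adjacent to v), so u has an anchor, coloured ≠ β,
-- and as d(u) ≤ 3 the anchor's colour occurs only once. This PCF-colours G, a contradiction.

module Submission where

open import Defs hiding (sym)
open import Function using (_∘_)
open import Data.Nat using (ℕ; zero; suc; _+_; _*_; _≤_; _<_; _≥_; z≤n; s≤s; _≡ᵇ_; _≤?_)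
open import Data.Nat.Properties
  using (≤-refl; ≤-reflexive; ≤-trans; ≤-antisym; ≤-<-trans; ≤-pred; <⇒≱; ≰⇒>; ≮⇒≥; m≤m+n; m≤n+m; n≤1+n;
         m≤n⇒m≤1+n; +-suc; +-identityʳ; +-mono-≤; +-monoˡ-≤; +-monoʳ-≤; +-cancelˡ-≤; ≡ᵇ⇒≡)
open import Data.Nat.Tactic.RingSolver using (solve-∀)
open import Data.Bool using (Bool; true; false; _∧_; _∨_; not)
open import Data.Bool.Properties
  using (∧-conicalˡ; ∧-conicalʳ; ∧-comm; ∧-identityʳ; ∧-zeroʳ; ∨-identityʳ; ∧-distribˡ-∨; ¬-not; T-≡)
  renaming (_≟_ to _≟ᵇ_)
open import Data.Fin using (Fin; zero; suc; _≟_)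
open import Data.Fin.Properties using (any?; suc-injective; injective⇒≤)
open import Data.List using (List; []; _∷_; _++_; map; length; allFin)
import Data.List as List
open import Data.List.Properties using (length-map; length-++)
open import Data.List.Membership.Propositional using (_∈_; _∉_)
open import Data.List.Membership.Propositional.Properties using (∈-map⁺; ∈-++⁺ˡ; ∈-++⁺ʳ; ∈-allFin)
open import Data.List.Relation.Unary.All as All using (All; []; _∷_)
open import Data.List.Relation.Unary.Any using (here; there; index) renaming (any? to any?ˡ)
open import Data.List.Relation.Unary.Any.Properties using (lookup-index)
open import Data.Vec.Functional using (updateAt)
open import Data.Vec.Functional.Properties using (updateAt-updates; updateAt-minimal)
open import Data.Product using (Σ; ∃; ∃₂; ∃-syntax; _×_; _,_; proj₁; proj₂; map₂)
open import Data.Sum using (_⊎_; inj₁; inj₂)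
open import Data.Empty using (⊥; ⊥-elim)
open import Function.Bundles using (Equivalence)
open import Relation.Binary.PropositionalEquality
open import Relation.Nullary using (¬_; Dec; yes; no; contradiction; _×-dec_)
open import Relation.Nullary.Decidable using (⌊_⌋; ¬?; decidable-stable)

⌊⌋-true : ∀ {a} {A : Set a} (a? : Dec A) → A → ⌊ a? ⌋ ≡ true
⌊⌋-true (yes _) _ = refl
⌊⌋-true (no ¬a) a = contradiction a ¬a

⌊⌋-false : ∀ {a} {A : Set a} (a? : Dec A) → ¬ A → ⌊ a? ⌋ ≡ false
⌊⌋-false (yes a) ¬a = contradiction a ¬a
⌊⌋-false (no _)  _  = refl

⌊⌋-sound : ∀ {a} {A : Set a} (a? : Dec A) → ⌊ a? ⌋ ≡ true → A
⌊⌋-sound (yes a) _ = a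

_⊆_ : ∀ {n} → (Fin n → Bool) → (Fin n → Bool) → Set
p ⊆ q = ∀ x → p x ≡ true → q x ≡ true

Disjoint : ∀ {n} → (Fin n → Bool) → (Fin n → Bool) → Set
Disjoint p q = ∀ x → p x ≡ true → q x ≡ true → ⊥

∧-intro : ∀ {a b} → a ≡ true → b ≡ true → a ∧ b ≡ true
∧-intro refl refl = refl

count-ext : ∀ {n} {p q : Fin n → Bool} → (∀ x → p x ≡ q x) → count p ≡ count q
count-ext {zero}  p≡q = refl
count-ext {suc n} p≡q rewrite p≡q zero = cong (_ +_) (count-ext (p≡q ∘ suc))

count-zero : ∀ {n} {p : Fin n → Bool} → (∀ x → p x ≡ false) → count p ≡ 0
count-zero {zero}  p≡false = refl
count-zero {suc n} p≡false rewrite p≡false zero = count-zero (p≡false ∘ suc)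

count-pos : ∀ {n} {p : Fin n → Bool} u → p u ≡ true → 1 ≤ count p
count-pos zero    pu rewrite pu = s≤s z≤n
count-pos (suc u) pu = ≤-trans (count-pos u pu) (m≤n+m _ _)

count-mono : ∀ {n} {p q : Fin n → Bool} → p ⊆ q → count p ≤ count q
count-mono {zero} p⊆q = z≤n
count-mono {suc n} {p} {q} p⊆q with p zero in p0 | q zero in q0
... | true  | true  = s≤s (count-mono (p⊆q ∘ suc))
... | true  | false = contradiction (trans (sym (p⊆q zero p0)) q0) λ ()
... | false | true  = m≤n⇒m≤1+n (count-mono (p⊆q ∘ suc))
... | false | false = count-mono (p⊆q ∘ suc)

count-≤1 : ∀ {n} {p : Fin n → Bool} u → (∀ x → p x ≡ true → x ≡ u) → count p ≤ 1
count-≤1 {suc n} {p} zero only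
  rewrite count-zero {p = p ∘ suc} (λ i → ¬-not λ pi → contradiction (only (suc i) pi) λ ())
  with p zero
... | true  = s≤s z≤n
... | false = z≤n
count-≤1 {suc n} {p} (suc u) only with p zero in p0
... | true  = contradiction (only zero p0) λ ()
... | false = count-≤1 u (λ i pi → suc-injective (only (suc i) pi))

count-second : ∀ {n} {p : Fin n → Bool} u → 2 ≤ count p → ∃[ y ] y ≢ u × p y ≡ true
count-second {p = p} u two with any? (λ y → ¬? (y ≟ u) ×-dec (p y ≟ᵇ true))
... | yes second = second
... | no none = contradiction (count-≤1 u only) (<⇒≱ two)
  where
    only : ∀ x → p x ≡ true → x ≡ u
    only x px = decidable-stable (x ≟ u) λ x≢u → none (x , x≢u , px)

count-∨ : ∀ {n} {p q : Fin n → Bool} → Disjoint p q → count (λ x → p x ∨ q x) ≡ count p + count q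
count-∨ {zero} disjoint = refl
count-∨ {suc n} {p} {q} disjoint with p zero in p0 | q zero in q0
... | true  | true  = ⊥-elim (disjoint zero p0 q0)
... | true  | false = cong suc (count-∨ (disjoint ∘ suc))
... | false | true  = trans (cong suc (count-∨ (disjoint ∘ suc))) (sym (+-suc _ _))
... | false | false = count-∨ (disjoint ∘ suc)

count-disjoint-≤ : ∀ {n} {p q r : Fin n → Bool} → Disjoint p q → p ⊆ r → q ⊆ r →
                   count p + count q ≤ count r
count-disjoint-≤ {p = p} {q} {r} disjoint p⊆r q⊆r =
  subst (_≤ count r) (count-∨ disjoint) (count-mono p∨q⊆r)
  where
    p∨q⊆r : (λ x → p x ∨ q x) ⊆ r
    p∨q⊆r x p∨q with p x in px
    ... | true  = p⊆r x px
    ... | false = q⊆r x p∨q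

count-< : ∀ {n} {p q : Fin n → Bool} u → p u ≡ false → q u ≡ true → p ⊆ q → suc (count p) ≤ count q
count-< zero pu qu p⊆q rewrite pu | qu = s≤s (count-mono (p⊆q ∘ suc))
count-< {p = p} {q} (suc u) pu qu p⊆q with p zero in p0 | q zero in q0
... | true  | true  = s≤s (count-< u pu qu (p⊆q ∘ suc))
... | true  | false = contradiction (trans (sym (p⊆q zero p0)) q0) λ ()
... | false | true  = m≤n⇒m≤1+n (count-< u pu qu (p⊆q ∘ suc))
... | false | false = count-< u pu qu (p⊆q ∘ suc)

count-insert : ∀ {n} {p q : Fin n → Bool} u → p u ≡ true → q u ≡ false →
               (∀ x → x ≢ u → p x ≡ q x) → count p ≡ suc (count q)
count-insert zero    pu qu elsewhere rewrite pu | qu =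
  cong suc (count-ext λ i → elsewhere (suc i) λ ())
count-insert (suc u) pu qu elsewhere rewrite elsewhere zero (λ ()) =
  trans (cong (_ +_) (count-insert u pu qu λ i i≢u → elsewhere (suc i) (i≢u ∘ suc-injective)))
        (+-suc _ _)

enum : ∀ {n} → (Fin n → Bool) → List (Fin n)
enum {zero}  p = []
enum {suc n} p with p zero
... | true  = zero ∷ map suc (enum (p ∘ suc))
... | false = map suc (enum (p ∘ suc))

length-enum : ∀ {n} (p : Fin n → Bool) → length (enum p) ≡ count p
length-enum {zero}  p = refl
length-enum {suc n} p with p zero
... | true  = cong suc (trans (length-map suc (enum (p ∘ suc))) (length-enum (p ∘ suc)))
... | false = trans (length-map suc (enum (p ∘ suc))) (length-enum (p ∘ suc))

∈-enum : ∀ {n} {p : Fin n → Bool} {x} → p x ≡ true → x ∈ enum p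
∈-enum {suc n} {p} {zero} px with p zero
... | true = here refl
∈-enum {suc n} {p} {suc x} px with p zero
... | true  = there (∈-map⁺ suc (∈-enum px))
... | false = ∈-map⁺ suc (∈-enum px)

∉-image : ∀ {n c} {p : Fin n → Bool} {α : Fin c} (g : Fin n → Fin c) {y} →
          α ∉ map g (enum p) → p y ≡ true → α ≢ g y
∉-image g α∉ py refl = α∉ (∈-map⁺ g (∈-enum py))

-- if L contained every colour, the position in L would inject Fin c into Fin (length L)
fresh : ∀ {c} (L : List (Fin c)) → length L < c → ∃[ α ] α ∉ L
fresh {c} L short with any? (λ α → ¬? (any?ˡ (α ≟_) L))
... | yes found = found
... | no none = contradiction (injective⇒≤ position-injective) (<⇒≱ short)
  where
    everywhere : ∀ α → α ∈ L
    everywhere α = decidable-stable (any?ˡ (α ≟_) L) λ α∉L → none (α , α∉L)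

    position : Fin c → Fin (length L)
    position α = index (everywhere α)

    position-injective : ∀ {α β} → position α ≡ position β → α ≡ β
    position-injective {α} {β} same =
      trans (lookup-index (everywhere α))
            (trans (cong (List.lookup L) same) (sym (lookup-index (everywhere β))))

choose : ∀ {n c} {P : Fin n → Fin c → Set} (W : Fin n → Bool) → (Fin n → Fin c) →
         (∀ z → W z ≡ true → ∃ (P z)) → Σ (Fin n → Fin c) λ g → ∀ z → W z ≡ true → P z (g z)
choose {n} {c} {P} W default h = g , g-spec
  where
    g : Fin n → Fin c
    g z with W z ≟ᵇ true
    ... | yes wz = proj₁ (h z wz)
    ... | no _   = default z

    g-spec : ∀ z → W z ≡ true → P z (g z)
    g-spec z wz with W z ≟ᵇ true
    ... | yes wz′ = proj₂ (h z wz′)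
    ... | no ¬wz  = contradiction wz ¬wz

module PartialColouring {n : ℕ} (G : Graph n) (c : ℕ) where

  VertexSet : Set
  VertexSet = Fin n → Bool

  Colouring : Set
  Colouring = Fin n → Fin c

  nbrsIn : VertexSet → Fin n → VertexSet
  nbrsIn S z y = adj G z y ∧ S y

  nbrsColoured : VertexSet → Colouring → Fin n → Fin c → VertexSet
  nbrsColoured S f z k y = nbrsIn S z y ∧ ⌊ f y ≟ k ⌋

  multiplicity : VertexSet → Colouring → Fin n → Fin c → ℕ
  multiplicity S f z k = count (nbrsColoured S f z k)

  Isolated : VertexSet → Fin n → Set
  Isolated S z = ∀ y → nbrsIn S z y ≡ false

  Witness : VertexSet → Colouring → Fin n → Fin c → Set
  Witness S f z k = Isolated S z ⊎ multiplicity S f z k ≡ 1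

  ProperOn : VertexSet → Colouring → Set
  ProperOn S f = ∀ a b → adj G a b ≡ true → S a ≡ true → S b ≡ true → f a ≢ f b

  Witnessed : VertexSet → VertexSet → Colouring → Set
  Witnessed W S f = ∀ z → W z ≡ true → ∃ (Witness S f z)

  PCFOn : VertexSet → Colouring → Set
  PCFOn S f = ProperOn S f × Witnessed S S f

  induced : VertexSet → Subgraph G
  induced S = record
    { vs     = S
    ; es     = λ a b → adj G a b ∧ S a ∧ S b
    ; es-sym = λ a b → cong₂ _∧_ (Graph.sym G a b) (∧-comm (S a) (S b))
    ; es-sub = λ a b → ∧-conicalˡ (adj G a b) _
    ; es-end = λ a b e → ∧-conicalˡ (S a) (S b) (∧-conicalʳ (adj G a b) _ e)
    }

  pcfOn-induced : ∀ {S} (χ : PCFColoring c (induced S)) → PCFOn S (PCFColoring.col χ)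
  pcfOn-induced {S} χ = proper′ , witnessed
    where
      open PCFColoring χ

      proper′ : ProperOn S col
      proper′ a b ab sa sb = proper a b (∧-intro ab (∧-intro sa sb))

      witnessed : Witnessed S S col
      witnessed z sz with any? (λ y → nbrsIn S z y ≟ᵇ true)
      ... | no none = col z , inj₁ λ y → ¬-not λ zy → none (y , zy)
      ... | yes (y , zy)
            with pcf z sz (y , ∧-intro (∧-conicalˡ (adj G z y) (S y) zy) (∧-intro sz (∧-conicalʳ (adj G z y) (S y) zy)))
      ...   | k , unique = k , inj₂ (trans (count-ext drop-sz) unique)
        where
          drop-sz : ∀ x → nbrsIn S z x ∧ ⌊ col x ≟ k ⌋ ≡ (adj G z x ∧ S z ∧ S x) ∧ ⌊ col x ≟ k ⌋
          drop-sz x = cong (λ s → (adj G z x ∧ s ∧ S x) ∧ ⌊ col x ≟ k ⌋) (sym sz)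

  pcf-whole : ∀ {S f} → PCFOn S f → (∀ x → S x ≡ true) → PCFColoring c (whole G)
  pcf-whole {S} {f} (proper , witnessed) everything = record
    { col    = f
    ; proper = λ a b ab → proper a b ab (everything a) (everything b)
    ; pcf    = pcf
    }
    where
      pcf : ∀ z → true ≡ true → ∃[ y ] adj G z y ≡ true → ∃[ k ] count (λ y → adj G z y ∧ ⌊ f y ≟ k ⌋) ≡ 1
      pcf z _ (y , zy) with witnessed z (everything z)
      ... | _ , inj₁ isolated = contradiction (trans (sym (isolated y)) (cong₂ _∧_ zy (everything y))) λ ()
      ... | k , inj₂ unique = k , trans (count-ext add-S) unique
        where
          add-S : ∀ x → adj G z x ∧ ⌊ f x ≟ k ⌋ ≡ nbrsIn S z x ∧ ⌊ f x ≟ k ⌋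
          add-S x rewrite everything x | ∧-identityʳ (adj G z x) = refl

  insert : VertexSet → Fin n → VertexSet
  insert S u = updateAt S u λ _ → true

  recolour : Colouring → Fin n → Fin c → Colouring
  recolour f u α = updateAt f u λ _ → α

  insert-here : ∀ S u → insert S u u ≡ true
  insert-here S u = updateAt-updates u S

  insert-elsewhere : ∀ S {u x} → x ≢ u → insert S u x ≡ S x
  insert-elsewhere S x≢u = updateAt-minimal _ _ S x≢u

  recolour-here : ∀ f u α → recolour f u α u ≡ α
  recolour-here f u α = updateAt-updates u f

  recolour-elsewhere : ∀ f {u x} α → x ≢ u → recolour f u α x ≡ f x
  recolour-elsewhere f α x≢u = updateAt-minimal _ _ f x≢u

  ∈⇒≢ : ∀ {S : VertexSet} {x u} → S x ≡ true → S u ≡ false → x ≢ u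
  ∈⇒≢ sx su refl = contradiction (trans (sym sx) su) λ ()

  insert-⊇ : ∀ S u → S ⊆ insert S u
  insert-⊇ S u x sx with x ≟ u
  ... | yes refl = insert-here S x
  ... | no x≢u   = trans (insert-elsewhere S x≢u) sx

  forbidden : VertexSet → VertexSet → Colouring → (Fin n → Fin c) → Fin n → List (Fin c)
  forbidden S W f key u = map f (enum (nbrsIn S u)) ++ map key (enum (nbrsIn W u))

  length-forbidden : ∀ S W f key u →
    length (forbidden S W f key u) ≡ count (nbrsIn S u) + count (nbrsIn W u)
  length-forbidden S W f key u =
    trans (length-++ (map f (enum (nbrsIn S u))))
          (cong₂ _+_ (trans (length-map f (enum (nbrsIn S u))) (length-enum (nbrsIn S u)))
                     (trans (length-map key (enum (nbrsIn W u))) (length-enum (nbrsIn W u))))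

  recolour-outside : ∀ {S : VertexSet} {x u} f γ → S x ≡ true → S u ≡ false → recolour f u γ x ≡ f x
  recolour-outside f γ sx su = recolour-elsewhere f γ (∈⇒≢ sx su)

  witnessed-insert : ∀ {W S f u} → Witnessed W S f → ∃ (Witness S f u) → Witnessed (insert W u) S f
  witnessed-insert {W} {u = u} witnessed at-u z wz with z ≟ u
  ... | yes refl = at-u
  ... | no z≢u   = witnessed z (trans (sym (insert-elsewhere W z≢u)) wz)

  coloured-nbr : ∀ S f {z k y} → nbrsColoured S f z k y ≡ true → adj G z y ≡ true × S y ≡ true × f y ≡ k
  coloured-nbr S f {z} {k} {y} hit =
    ∧-conicalˡ (adj G z y) (S y) nbr , ∧-conicalʳ (adj G z y) (S y) nbr ,
    ⌊⌋-sound (f y ≟ k) (∧-conicalʳ (nbrsIn S z y) _ hit)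
    where
      nbr : nbrsIn S z y ≡ true
      nbr = ∧-conicalˡ (nbrsIn S z y) _ hit

  crowded-witness : ∀ {S f z k b} → deg G z ≤ 3 → 2 ≤ multiplicity S f z k →
                    nbrsIn S z b ≡ true → f b ≢ k → multiplicity S f z (f b) ≡ 1
  crowded-witness {S} {f} {z} {k} {b} small crowded zb fb≢k = ≤-antisym at-most-one at-least-one
    where
      at-least-one : 1 ≤ count (nbrsColoured S f z (f b))
      at-least-one = count-pos b (∧-intro zb (⌊⌋-true (f b ≟ f b) refl))

      coloured-adj : ∀ j → nbrsColoured S f z j ⊆ adj G z
      coloured-adj j y e = proj₁ (coloured-nbr S f e)

      apart : Disjoint (nbrsColoured S f z k) (nbrsColoured S f z (f b))
      apart y is-k is-fb =
        fb≢k (trans (sym (proj₂ (proj₂ (coloured-nbr S f is-fb)))) (proj₂ (proj₂ (coloured-nbr S f is-k))))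

      at-most-one : count (nbrsColoured S f z (f b)) ≤ 1
      at-most-one = +-cancelˡ-≤ 2 _ 1
        (≤-trans (+-monoˡ-≤ _ crowded)
                 (≤-trans (count-disjoint-≤ apart (coloured-adj k) (coloured-adj (f b))) small))

  module Extension {S : VertexSet} {u : Fin n} (u∉S : S u ≡ false) (f : Colouring) (α : Fin c) where

    S′ : VertexSet
    S′ = insert S u

    f′ : Colouring
    f′ = recolour f u α

    away-from-u : ∀ z k y → y ≢ u → nbrsIn S′ z y ∧ ⌊ f′ y ≟ k ⌋ ≡ nbrsIn S z y ∧ ⌊ f y ≟ k ⌋
    away-from-u z k y y≢u rewrite insert-elsewhere S y≢u | recolour-elsewhere f α y≢u = refl

    multiplicity-unchanged : ∀ z k → (adj G z u ≡ true → α ≢ k) →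
                             multiplicity S′ f′ z k ≡ multiplicity S f z k
    multiplicity-unchanged z k α≢k = count-ext pointwise
      where
        pointwise : ∀ y → nbrsIn S′ z y ∧ ⌊ f′ y ≟ k ⌋ ≡ nbrsIn S z y ∧ ⌊ f y ≟ k ⌋
        pointwise y with y ≟ u
        ... | no y≢u = away-from-u z k y y≢u
        ... | yes refl rewrite insert-here S y | recolour-here f y α | u∉S with adj G z y
        ...   | true  = ⌊⌋-false (α ≟ k) (α≢k refl)
        ...   | false = refl

    multiplicity-new : ∀ z → adj G z u ≡ true → multiplicity S′ f′ z α ≡ suc (multiplicity S f z α)
    multiplicity-new z zu = count-insert u now before (away-from-u z α)
      where
        now : nbrsIn S′ z u ∧ ⌊ f′ u ≟ α ⌋ ≡ true
        now rewrite insert-here S u | recolour-here f u α | zu = ⌊⌋-true (α ≟ α) refl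

        before : nbrsIn S z u ∧ ⌊ f u ≟ α ⌋ ≡ false
        before rewrite u∉S | zu = refl

    isolated-insert : ∀ {z} → Isolated S z → adj G z u ≡ false → Isolated S′ z
    isolated-insert {z} isolated zu y with y ≟ u
    ... | yes refl rewrite zu = refl
    ... | no y≢u   = trans (cong (adj G z y ∧_) (insert-elsewhere S y≢u)) (isolated y)

    witness-extend : ∀ {z k} → Witness S f z k → (adj G z u ≡ true → α ≢ k) → ∃ (Witness S′ f′ z)
    witness-extend {z} {k} (inj₁ isolated) _ with adj G z u in zu
    ... | true  = α , inj₂ (trans (multiplicity-new z zu) (cong suc (count-zero λ y → cong (_∧ _) (isolated y))))
    ... | false = k , inj₁ (isolated-insert isolated zu)
    witness-extend {z} {k} (inj₂ unique) α≢k = k , inj₂ (trans (multiplicity-unchanged z k α≢k) unique)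

    witness-self : ∀ {k} → Witness S f u k → Witness S′ f′ u k
    witness-self (inj₁ isolated) = inj₁ (isolated-insert isolated (irrefl G u))
    witness-self {k} (inj₂ unique) = inj₂ (trans (multiplicity-unchanged u k no-loop) unique)
      where
        no-loop : adj G u u ≡ true → α ≢ k
        no-loop uu = contradiction (trans (sym uu) (irrefl G u)) λ ()

    proper-extend : ProperOn S f → (∀ y → nbrsIn S u y ≡ true → α ≢ f y) → ProperOn S′ f′
    proper-extend proper avoids a b ab sa sb with a ≟ u | b ≟ u
    ... | yes refl | yes refl = contradiction (trans (sym ab) (irrefl G a)) λ ()
    ... | yes refl | no b≢u rewrite recolour-here f a α | recolour-elsewhere f α b≢u =
          avoids b (∧-intro ab (trans (sym (insert-elsewhere S b≢u)) sb))
    ... | no a≢u | yes refl rewrite recolour-here f b α | recolour-elsewhere f α a≢u =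
          avoids a (∧-intro (trans (Graph.sym G b a) ab) (trans (sym (insert-elsewhere S a≢u)) sa)) ∘ sym
    ... | no a≢u | no b≢u rewrite recolour-elsewhere f α a≢u | recolour-elsewhere f α b≢u =
          proper a b ab (trans (sym (insert-elsewhere S a≢u)) sa) (trans (sym (insert-elsewhere S b≢u)) sb)

    extend : ∀ {W key} → ProperOn S f → (∀ z → W z ≡ true → Witness S f z (key z)) →
             α ∉ forbidden S W f key u → ProperOn S′ f′ × Witnessed W S′ f′
    extend {W} {key} proper witnessed α∉ =
      proper-extend proper (λ y uy → ∉-image f (α∉ ∘ ∈-++⁺ˡ) uy) ,
      λ z wz → witness-extend (witnessed z wz)
                 (λ zu → ∉-image key (α∉ ∘ ∈-++⁺ʳ _) (∧-intro (trans (Graph.sym G u z) zu) wz))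

halve-budget : ∀ a d c → 2 * (a + d) < d + c → a + a + d < c
halve-budget a d c lt = +-cancelˡ-≤ d _ _ (subst (_≤ d + c) (shift a d) lt)
  where
    shift : ∀ a d → suc (2 * (a + d)) ≡ d + suc (a + a + d)
    shift = solve-∀

small-budget : ∀ a d c → a + a + d < c → 1 ≤ d → 5 ≤ c → 3 + a < c
small-budget 0 d c _ _ c≥5 = ≤-trans (n≤1+n 4) c≥5
small-budget 1 d c _ _ c≥5 = c≥5
small-budget (suc (suc a)) d c lt d≥1 _ = ≤-<-trans grow lt
  where
    grow : 3 + suc (suc a) ≤ suc (suc a) + suc (suc a) + d
    grow = subst (_≤ suc (suc a) + suc (suc a) + d) (regroup a)
             (+-mono-≤ (+-monoʳ-≤ (suc (suc a)) (m≤m+n 2 a)) d≥1)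
      where
        regroup : ∀ a → suc (suc a) + 2 + 1 ≡ 3 + suc (suc a)
        regroup = solve-∀

module NeighbourhoodBound
  (c : ℕ) (c≥5 : c ≥ 5) {n : ℕ} (G : Graph n) (critical : PCFCritical c G) (v : Fin n)
  (D : Fin n → Bool) (D⊆N : D ⊆ adj G v)
  (D-small : ∀ u → D u ≡ true → deg G u ≤ 3 × 2 * deg G u < c)
  (w : Fin n) (Dw : D w ≡ true) (deg-w : deg G w ≤ 2)
  where

  open PartialColouring G c

  Rest : VertexSet
  Rest u = not (D u) ∧ not ⌊ u ≟ v ⌋

  A : VertexSet
  A = nbrsIn Rest v

  Dv : D v ≡ false
  Dv = ¬-not λ dv → contradiction (trans (sym (D⊆N v dv)) (irrefl G v)) λ ()

  Rest-v : Rest v ≡ false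
  Rest-v rewrite ⌊⌋-true (v ≟ v) refl = ∧-zeroʳ _

  Rest-D : ∀ {u} → D u ≡ true → Rest u ≡ false
  Rest-D du rewrite du = refl

  Rest-intro : ∀ {u} → D u ≡ false → u ≢ v → Rest u ≡ true
  Rest-intro {u} du u≢v rewrite du | ⌊⌋-false (u ≟ v) u≢v = refl

  outside-Rest : ∀ {u} → Rest u ≡ false → D u ≡ true ⊎ u ≡ v
  outside-Rest {u} ru with D u | u ≟ v
  ... | true  | _        = inj₁ refl
  ... | false | yes u≡v  = inj₂ u≡v
  ... | false | no _     = contradiction ru λ ()

  degree-split : deg G v ≡ count A + count D
  degree-split = trans (count-ext split) (count-∨ A-D-disjoint)
    where
      A-D-disjoint : Disjoint A D
      A-D-disjoint u au du = contradiction (trans (sym (∧-conicalʳ (adj G v u) _ au)) (Rest-D du)) λ ()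

      split : ∀ u → adj G v u ≡ (adj G v u ∧ (not (D u) ∧ not ⌊ u ≟ v ⌋)) ∨ D u
      split u with D u in du | u ≟ v
      ... | true  | _        rewrite D⊆N u du = refl
      ... | false | yes refl rewrite irrefl G v = refl
      ... | false | no _     = sym (trans (∨-identityʳ _) (∧-identityʳ _))

  χ : PCFColoring c (induced Rest)
  χ = proj₂ critical (induced Rest) (inj₁ (v , Rest-v))

  φ : Colouring
  φ = PCFColoring.col χ

  φ-pcf : PCFOn Rest φ
  φ-pcf = pcfOn-induced χ

  anchor : Fin n → Fin n
  anchor u with any? (λ y → nbrsIn Rest u y ≟ᵇ true)
  ... | yes (y , _) = y
  ... | no _        = u

  anchor-nbr : ∀ {u y} → nbrsIn Rest u y ≡ true → nbrsIn Rest u (anchor u) ≡ true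
  anchor-nbr {u} {y} uy with any? (λ y → nbrsIn Rest u y ≟ᵇ true)
  ... | yes (_ , uz) = uz
  ... | no none      = contradiction (y , uy) none

  record Extends (β : Fin c) (S : VertexSet) (f : Colouring) : Set where
    field
      proper : ProperOn S f
      v∈S    : S v ≡ true
      f-v    : f v ≡ β
      Rest⊆S : Rest ⊆ S
      f-Rest : ∀ y → Rest y ≡ true → f y ≡ φ y

  extends-insert : ∀ {β S f u γ} → Extends β S f → S u ≡ false →
                    ProperOn (insert S u) (recolour f u γ) → Extends β (insert S u) (recolour f u γ)
  extends-insert {S = S} {f} {u} {γ} ext su proper′ = record
    { proper = proper′
    ; v∈S    = insert-⊇ S u v v∈S
    ; f-v    = trans (recolour-outside f γ v∈S su) f-v
    ; Rest⊆S = λ y ry → insert-⊇ S u y (Rest⊆S y ry)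
    ; f-Rest = λ y ry → trans (recolour-outside f γ (Rest⊆S y ry) su) (f-Rest y ry)
    }
    where open Extends ext

  missing-in-D : ∀ {β S f x} → Extends β S f → S x ≡ false → D x ≡ true
  missing-in-D {x = x} ext sx
    with outside-Rest (¬-not λ rx → contradiction (trans (sym (Extends.Rest⊆S ext x rx)) sx) λ ())
  ... | inj₁ dx   = dx
  ... | inj₂ refl = contradiction (trans (sym (Extends.v∈S ext)) sx) λ ()

  module Centre (β : Fin c) (β-anchors : ∀ u → D u ≡ true → β ≢ φ (anchor u)) where

    D-witness : ∀ {S f u} → Extends β S f → D u ≡ true → ∃ (Witness S f u)
    D-witness {S} {f} {u} ext du with multiplicity S f u β ≤? 1
    ... | yes at-most-one = β , inj₂ (≤-antisym at-most-one (count-pos v v-coloured-β))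
      where
        open Extends ext

        v-coloured-β : nbrsColoured S f u β v ≡ true
        v-coloured-β = ∧-intro (∧-intro (trans (Graph.sym G u v) (D⊆N u du)) v∈S) (⌊⌋-true (f v ≟ β) f-v)
    ... | no crowded with count-second v (≰⇒> crowded)
    ...   | y , y≢v , hit = f (anchor u) ,
            inj₂ (crowded-witness (proj₁ (D-small u du)) (≰⇒> crowded) anchor-in-S anchor-not-β)
      where
        open Extends ext

        uy : adj G u y ≡ true
        uy = proj₁ (coloured-nbr S f hit)

        sy : S y ≡ true
        sy = proj₁ (proj₂ (coloured-nbr S f hit))

        fy : f y ≡ β
        fy = proj₂ (proj₂ (coloured-nbr S f hit))

        -- a second β-neighbour cannot lie in D, whose vertices are adjacent to v
        y∈Rest : Rest y ≡ true
        y∈Rest = Rest-intro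
          (¬-not λ dy → proper y v (trans (Graph.sym G y v) (D⊆N y dy)) sy v∈S (trans fy (sym f-v))) y≢v

        anchor-in-Rest : nbrsIn Rest u (anchor u) ≡ true
        anchor-in-Rest = anchor-nbr (∧-intro uy y∈Rest)

        anchor-Rest : Rest (anchor u) ≡ true
        anchor-Rest = ∧-conicalʳ (adj G u (anchor u)) _ anchor-in-Rest

        anchor-in-S : nbrsIn S u (anchor u) ≡ true
        anchor-in-S = ∧-intro (∧-conicalˡ (adj G u (anchor u)) _ anchor-in-Rest) (Rest⊆S _ anchor-Rest)

        anchor-not-β : f (anchor u) ≢ β
        anchor-not-β e = β-anchors u du (trans (sym e) (f-Rest _ anchor-Rest))

    Stage : VertexSet → Colouring → Set
    Stage S f = Extends β S f × Witnessed S S f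

    absorb : ∀ {S f} x → Stage S f → ∃₂ λ S′ f′ → Stage S′ f′ × S ⊆ S′ × S′ x ≡ true
    absorb {S} {f} x stage with S x in sx
    ... | true  = S , f , stage , (λ _ e → e) , sx
    ... | false = insert S x , recolour f x γ ,
                  (extends-insert ext sx (proj₁ extended) ,
                   witnessed-insert (proj₂ extended) (map₂ witness-self (D-witness ext dx))) ,
                  insert-⊇ S x , insert-here S x
      where
        ext : Extends β S f
        ext = proj₁ stage

        dx : D x ≡ true
        dx = missing-in-D ext sx

        witnesses : Σ (Fin n → Fin c) λ key → ∀ z → S z ≡ true → Witness S f z (key z)
        witnesses = choose S f (proj₂ stage)

        key : Fin n → Fin c
        key = proj₁ witnesses

        short : length (forbidden S S f key x) < c
        short = ≤-<-trans (≤-reflexive (length-forbidden S S f key x))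
                  (≤-<-trans (+-mono-≤ at-most-deg (≤-trans at-most-deg (≤-reflexive (sym (+-identityʳ _)))))
                             (proj₂ (D-small x dx)))
          where
            at-most-deg : count (nbrsIn S x) ≤ deg G x
            at-most-deg = count-mono λ y e → ∧-conicalˡ (adj G x y) (S y) e

        γ : Fin c
        γ = proj₁ (fresh _ short)

        open Extension {S} {x} sx f γ

        extended : ProperOn S′ f′ × Witnessed S S′ f′
        extended = extend (Extends.proper ext) (proj₂ witnesses) (proj₂ (fresh _ short))

    absorb-all : ∀ {S f} (xs : List (Fin n)) → Stage S f →
                 ∃₂ λ S′ f′ → Stage S′ f′ × All (λ x → S′ x ≡ true) xs
    absorb-all {S} {f} []       stage = S , f , stage , []
    absorb-all         (x ∷ xs) stage with absorb-all xs stage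
    ... | S′ , f′ , stage′ , xs∈S′ with absorb x stage′
    ...   | S″ , f″ , stage″ , S′⊆S″ , x∈S″ = S″ , f″ , stage″ , x∈S″ ∷ All.map (S′⊆S″ _) xs∈S′

    no-stage : ∀ {S f} → Stage S f → ⊥
    no-stage stage with absorb-all (allFin n) stage
    ... | _ , _ , (ext , witnessed) , everything =
      proj₁ critical (pcf-whole (Extends.proper ext , witnessed) λ x → All.lookup everything (∈-allFin x))

  module TooFewColours (too-small : 2 * deg G v < count D + c) where

    budget : count A + count A + count D < c
    budget = halve-budget (count A) (count D) c (subst (λ d → 2 * d < count D + c) degree-split too-small)

    φ-witnesses : Σ (Fin n → Fin c) λ key → ∀ z → Rest z ≡ true → Witness Rest φ z (key z)
    φ-witnesses = choose Rest φ (proj₂ φ-pcf)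

    keyφ : Fin n → Fin c
    keyφ = proj₁ φ-witnesses

    β-forbidden : List (Fin c)
    β-forbidden = forbidden Rest Rest φ keyφ v ++ map (φ ∘ anchor) (enum D)

    β-short : length β-forbidden < c
    β-short = subst (_< c) (sym length-β) budget
      where
        length-β : length β-forbidden ≡ count A + count A + count D
        length-β = trans (length-++ (forbidden Rest Rest φ keyφ v))
                         (cong₂ _+_ (length-forbidden Rest Rest φ keyφ v)
                                    (trans (length-map (φ ∘ anchor) (enum D)) (length-enum D)))

    β : Fin c
    β = proj₁ (fresh β-forbidden β-short)

    β∉ : β ∉ β-forbidden
    β∉ = proj₂ (fresh β-forbidden β-short)

    β-anchors : ∀ u → D u ≡ true → β ≢ φ (anchor u)
    β-anchors u du = ∉-image {p = D} (φ ∘ anchor) (β∉ ∘ ∈-++⁺ʳ (forbidden Rest Rest φ keyφ v)) du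

    open Centre β β-anchors

    module E₁ = Extension {Rest} {v} Rest-v φ β

    extended₁ : ProperOn E₁.S′ E₁.f′ × Witnessed Rest E₁.S′ E₁.f′
    extended₁ = E₁.extend (proj₁ φ-pcf) (proj₂ φ-witnesses) (β∉ ∘ ∈-++⁺ˡ)

    extends₁ : Extends β E₁.S′ E₁.f′
    extends₁ = record
      { proper = proj₁ extended₁
      ; v∈S    = insert-here Rest v
      ; f-v    = recolour-here φ v β
      ; Rest⊆S = insert-⊇ Rest v
      ; f-Rest = λ y ry → recolour-outside φ β ry Rest-v
      }

    w∉S₁ : E₁.S′ w ≡ false
    w∉S₁ = trans (insert-elsewhere Rest (∈⇒≢ {S = D} Dw Dv)) (Rest-D Dw)

    witnesses₁ : Σ (Fin n → Fin c) λ key → ∀ z → Rest z ≡ true → Witness E₁.S′ E₁.f′ z (key z)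
    witnesses₁ = choose Rest E₁.f′ (proj₂ extended₁)

    key₁ : Fin n → Fin c
    key₁ = proj₁ witnesses₁

    α-forbidden : List (Fin c)
    α-forbidden = forbidden E₁.S′ Rest E₁.f′ key₁ w ++ map φ (enum A)

    α-short : length α-forbidden < c
    α-short = ≤-<-trans length-α (small-budget (count A) (count D) c budget (count-pos w Dw) c≥5)
      where
        w-nbrs : count (nbrsIn E₁.S′ w) ≤ 2
        w-nbrs = ≤-trans (count-mono λ y e → ∧-conicalˡ (adj G w y) _ e) deg-w

        -- v is a neighbour of w outside Rest
        w-Rest-nbrs : count (nbrsIn Rest w) ≤ 1
        w-Rest-nbrs = ≤-pred (≤-trans (count-< v (trans (cong (adj G w v ∧_) Rest-v) (∧-zeroʳ _))
                                                 (trans (Graph.sym G w v) (D⊆N w Dw))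
                                                 λ y e → ∧-conicalˡ (adj G w y) _ e)
                                      deg-w)

        length-α : length α-forbidden ≤ 3 + count A
        length-α = ≤-trans (≤-reflexive (trans (length-++ (forbidden E₁.S′ Rest E₁.f′ key₁ w))
                              (cong₂ _+_ (length-forbidden E₁.S′ Rest E₁.f′ key₁ w)
                                         (trans (length-map φ (enum A)) (length-enum A)))))
                           (+-monoˡ-≤ (count A) (+-mono-≤ w-nbrs w-Rest-nbrs))

    α : Fin c
    α = proj₁ (fresh α-forbidden α-short)

    α∉ : α ∉ α-forbidden
    α∉ = proj₂ (fresh α-forbidden α-short)

    module E₂ = Extension {E₁.S′} {w} w∉S₁ E₁.f′ α

    extended₂ : ProperOn E₂.S′ E₂.f′ × Witnessed Rest E₂.S′ E₂.f′
    extended₂ = E₂.extend (proj₁ extended₁) (proj₂ witnesses₁) (α∉ ∘ ∈-++⁺ˡ)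

    v-witness : multiplicity E₂.S′ E₂.f′ v α ≡ 1
    v-witness = trans (E₂.multiplicity-new v (D⊆N w Dw)) (cong suc (count-zero λ y → ¬-not (no-α y)))
      where
        no-α : ∀ y → nbrsColoured E₁.S′ E₁.f′ v α y ≢ true
        no-α y hit = ∉-image {p = A} φ (α∉ ∘ ∈-++⁺ʳ (forbidden E₁.S′ Rest E₁.f′ key₁ w)) (∧-intro vy ry)
                       (trans (sym fy) (recolour-outside φ β ry Rest-v))
          where
            vy : adj G v y ≡ true
            vy = proj₁ (coloured-nbr E₁.S′ E₁.f′ hit)

            fy : E₁.f′ y ≡ α
            fy = proj₂ (proj₂ (coloured-nbr E₁.S′ E₁.f′ hit))

            y≢v : y ≢ v
            y≢v refl = contradiction (trans (sym vy) (irrefl G v)) λ ()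

            ry : Rest y ≡ true
            ry = trans (sym (insert-elsewhere Rest y≢v)) (proj₁ (proj₂ (coloured-nbr E₁.S′ E₁.f′ hit)))

    stage₂ : Stage E₂.S′ E₂.f′
    stage₂ = extends-insert extends₁ w∉S₁ (proj₁ extended₂) ,
             witnessed-insert (witnessed-insert (proj₂ extended₂) (α , inj₂ v-witness))
                              (map₂ E₂.witness-self (D-witness extends₁ Dw))

    impossible : ⊥
    impossible = no-stage stage₂

  bound : count D + c ≤ 2 * deg G v
  bound = ≮⇒≥ TooFewColours.impossible

neighbourhood-bound : ∀ c → c ≥ 5 → ∀ {n} (G : Graph n) → PCFCritical c G → ∀ v (D : Fin n → Bool) →
  D ⊆ adj G v → (∀ u → D u ≡ true → deg G u ≤ 3 × 2 * deg G u < c) →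
  (∃[ w ] D w ≡ true × deg G w ≤ 2) → count D + c ≤ 2 * deg G v
neighbourhood-bound c c≥5 G critical v D D⊆N D-small (w , Dw , deg-w) =
  NeighbourhoodBound.bound c c≥5 G critical v D D⊆N D-small w Dw deg-w

≡ᵇ-sound : ∀ {m k} → (m ≡ᵇ k) ≡ true → m ≡ k
≡ᵇ-sound {m} {k} e = ≡ᵇ⇒≡ m k (Equivalence.from T-≡ e)

degree-two-bound : ∀ c → c ≥ 5 → ∀ {n} (G : Graph n) → PCFCritical c G → ∀ v →
  (∃[ w ] adj G v w ≡ true × deg G w ≡ 2) → nbrsOfDeg G 2 v + c ≤ 2 * deg G v
degree-two-bound c c≥5 G critical v (w , vw , deg-w) =
  neighbourhood-bound c c≥5 G critical v D₂ (λ u → ∧-conicalˡ (adj G v u) _) small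
    (w , cong₂ _∧_ vw (cong (_≡ᵇ 2) deg-w) , ≤-reflexive deg-w)
  where
    D₂ : Fin _ → Bool
    D₂ u = adj G v u ∧ (deg G u ≡ᵇ 2)

    small : ∀ u → D₂ u ≡ true → deg G u ≤ 3 × 2 * deg G u < c
    small u e rewrite ≡ᵇ-sound {deg G u} {2} (∧-conicalʳ (adj G v u) _ e) = s≤s (s≤s z≤n) , c≥5

degree-two-three-bound : ∀ c → c ≥ 7 → ∀ {n} (G : Graph n) → PCFCritical c G → ∀ v →
  (∃[ w ] adj G v w ≡ true × deg G w ≡ 2) → nbrsOfDeg G 2 v + nbrsOfDeg G 3 v + c ≤ 2 * deg G v
degree-two-three-bound c c≥7 G critical v (w , vw , deg-w) =
  subst (λ m → m + c ≤ 2 * deg G v) split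
    (neighbourhood-bound c c≥5 G critical v D₂₃
      (λ u → ∧-conicalˡ (adj G v u) _) small
      (w , cong₂ _∧_ vw (cong (λ d → (d ≡ᵇ 2) ∨ (d ≡ᵇ 3)) deg-w) , ≤-reflexive deg-w))
  where
    c≥5 : c ≥ 5
    c≥5 = ≤-trans (m≤m+n 5 2) c≥7

    D₂₃ : Fin _ → Bool
    D₂₃ u = adj G v u ∧ ((deg G u ≡ᵇ 2) ∨ (deg G u ≡ᵇ 3))

    small : ∀ u → D₂₃ u ≡ true → deg G u ≤ 3 × 2 * deg G u < c
    small u e with deg G u ≡ᵇ 2 in two
    ... | true  rewrite ≡ᵇ-sound {deg G u} {2} two = s≤s (s≤s z≤n) , c≥5
    ... | false rewrite ≡ᵇ-sound {deg G u} {3} (∧-conicalʳ (adj G v u) _ e) = ≤-refl , c≥7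

    two-or-three : Disjoint (λ u → adj G v u ∧ (deg G u ≡ᵇ 2)) (λ u → adj G v u ∧ (deg G u ≡ᵇ 3))
    two-or-three u two three =
      contradiction (trans (sym (≡ᵇ-sound {deg G u} {2} (∧-conicalʳ (adj G v u) _ two)))
                           (≡ᵇ-sound {deg G u} {3} (∧-conicalʳ (adj G v u) _ three))) λ ()

    split : count D₂₃ ≡ nbrsOfDeg G 2 v + nbrsOfDeg G 3 v
    split = trans (count-ext λ u → ∧-distribˡ-∨ (adj G v u) _ _) (count-∨ two-or-three)

lemma2p4 : (c : ℕ) → c ≥ 5 → {n : ℕ} → (G : Graph n) → PCFCritical c G →
    (v : Fin n) → (∃[ w ] (adj G v w ≡ true × deg G w ≡ 2)) →
    (2 * deg G v ≥ nbrsOfDeg G 2 v + c)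
    × (c ≥ 7 → 2 * deg G v ≥ nbrsOfDeg G 2 v + nbrsOfDeg G 3 v + c)
lemma2p4 c c≥5 G critical v has-degree-two-nbr =
  degree-two-bound c c≥5 G critical v has-degree-two-nbr ,
  λ c≥7 → degree-two-three-bound c c≥7 G critical v has-degree-two-nbr
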